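{- Let $\mathrm{PR}$ be the model over $\mathbb N$ consisting of all partial recursive functions $\mathbb N\to\mathbb N\cup\{\bot\}$. Then $\mathrm{PR}$ is complete: for every model $M$ over $\mathbb N$ with $M\supseteq\mathrm{PR}$ and $\mathrm{PR}\succsim M$, we have $M=\mathrm{PR}$.
   Context: A model of computation over a set $D$ is any set of functions $f:D\to D\cup\{\bot\}$, where $\bot$ denotes "undefined" (a partial function is identified with such a function, $\bot$ marking the points where it is undefined). An encoding is an injection $\rho:\mathrm{dom}\,B\to\mathrm{dom}\,A$, extended by $\rho(\bot)=\bot$. Model $A$ simulates model $B$ via $\rho$, written $A\succsim_\rho B$, if for every $g\in B$ there is $f\in A$ with $\rho\circ g=f\circ\rho$. $A\succsim B$ means $A\succsim_\rho B$ for some injection $\rho$. -}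

module Defs where

open import Data.Nat using (ℕ; zero; suc; _<_)
open import Data.Fin using (Fin)
open import Data.Vec using (Vec; []; _∷_; lookup; tabulate)
open import Data.Product using (Σ; ∃; _×_; _,_)
open import Relation.Binary.PropositionalEquality using (_≡_)
open import Function.Definitions using (Injective)
open import Function.Bundles using (_⇔_)

-- Partial functions ℕ → ℕ ∪ {⊥}, represented by their graphs
-- (graph x y  means  f(x) = y;  f(x) = ⊥  iff no y with graph x y).

record PFun : Set₁ where
  field
    graph      : ℕ → ℕ → Set
    functional : ∀ {x y z} → graph x y → graph x z → y ≡ z
open PFun public

Model : Set₁
Model = PFun → Set

_≐_ : PFun → PFun → Set
f ≐ g = ∀ x y → graph f x y ⇔ graph g x y

data Prog : ℕ → Set where
  zeroP : Prog 0
  succP : Prog 1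
  projP : ∀ {n} → Fin n → Prog n
  compP : ∀ {m n} → Prog m → (Fin m → Prog n) → Prog n
  primP : ∀ {n} → Prog n → Prog (suc (suc n)) → Prog (suc n)
  muP   : ∀ {n} → Prog (suc n) → Prog n

data Eval : ∀ {n} → Prog n → Vec ℕ n → ℕ → Set where
  evZero : Eval zeroP [] 0
  evSucc : ∀ {x} → Eval succP (x ∷ []) (suc x)
  evProj : ∀ {n} {i : Fin n} {xs} → Eval (projP i) xs (lookup xs i)
  evComp : ∀ {m n} {f : Prog m} {gs : Fin m → Prog n} {xs} {vs : Fin m → ℕ} {y}
         → (∀ i → Eval (gs i) xs (vs i))
         → Eval f (tabulate vs) y
         → Eval (compP f gs) xs y
  evPrim0 : ∀ {n} {f : Prog n} {g} {xs} {y}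
          → Eval f xs y → Eval (primP f g) (0 ∷ xs) y
  evPrimS : ∀ {n} {f : Prog n} {g} {k xs r y}
          → Eval (primP f g) (k ∷ xs) r
          → Eval g (k ∷ r ∷ xs) y
          → Eval (primP f g) (suc k ∷ xs) y
  evMu : ∀ {n} {f : Prog (suc n)} {xs} {y}
       → Eval f (y ∷ xs) 0
       → (∀ z → z < y → Σ ℕ λ k → Eval f (z ∷ xs) (suc k))
       → Eval (muP f) xs y

PR : Model
PR f = Σ (Prog 1) λ p → ∀ x y → graph f x y ⇔ Eval p (x ∷ []) y

-- ρ ∘ g = f ∘ ρ  (with ρ(⊥) = ⊥), as an equality of partial functions
Commutes : (ℕ → ℕ) → PFun → PFun → Set
Commutes ρ g f = ∀ x z → (Σ ℕ λ y → graph g x y × ρ y ≡ z) ⇔ graph f (ρ x) z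

Simulates : Model → (ℕ → ℕ) → Model → Set₁
Simulates A ρ B = ∀ g → B g → Σ PFun λ f → A f × Commutes ρ g f

_≿_ : Model → Model → Set₁
A ≿ B = Σ (ℕ → ℕ) λ ρ → Injective _≡_ _≡_ ρ × Simulates A ρ B

_⊆M_ : Model → Model → Set₁
A ⊆M B = ∀ f → A f → B f

_≡M_ : Model → Model → Set₁
A ≡M B = ∀ f → (A f → B f) × (B f → A f)

-- The successor function lies in PR ⊆ M, so PR contains some f with f (ρ n) = ρ (n + 1);
-- iterating f from ρ 0 shows that the encoding ρ is itself recursive. Being injective, ρ then
-- has a recursive left inverse, found by μ-search for the n with ρ n = w. Every g ∈ M is
-- simulated by some f ∈ PR, so g = ρ⁻¹ ∘ f ∘ ρ is partial recursive.
module Submission where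

open import Defs
open import Data.Nat using (ℕ; zero; suc; pred; _+_; _∸_; _<_)
open import Data.Nat.Properties
  using (<-cmp; <-irrefl; pred[m∸n]≡m∸[1+n]; n∸n≡0; m∸n≡0⇒m≤n; m+n≡0⇒m≡0; m+n≡0⇒n≡0; ≤-antisym)
open import Data.Fin using (zero; suc)
open import Data.Vec using ([]; _∷_; lookup)
open import Data.Vec.Properties using (tabulate-cong)
open import Data.Product using (∃; _×_; _,_)
open import Relation.Nullary using (contradiction)
open import Relation.Binary using (tri<; tri≈; tri>)
open import Relation.Binary.PropositionalEquality
  using (_≡_; _≢_; refl; sym; trans; cong₂; subst)
open import Function.Definitions using (Injective)
open import Function.Bundles using (mk⇔; Equivalence)
open Equivalence using (to; from)

Eval-deterministic : ∀ {n} {p : Prog n} {xs y z} → Eval p xs y → Eval p xs z → y ≡ z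
Eval-deterministic evZero evZero = refl
Eval-deterministic evSucc evSucc = refl
Eval-deterministic evProj evProj = refl
Eval-deterministic (evComp {f = f} args e) (evComp args′ e′) =
  Eval-deterministic e
    (subst (λ vs → Eval f vs _)
           (sym (tabulate-cong (λ i → Eval-deterministic (args i) (args′ i)))) e′)
Eval-deterministic (evPrim0 e) (evPrim0 e′) = Eval-deterministic e e′
Eval-deterministic (evPrimS {g = g} r e) (evPrimS r′ e′) =
  Eval-deterministic e
    (subst (λ v → Eval g (_ ∷ v ∷ _) _) (sym (Eval-deterministic r r′)) e′)
Eval-deterministic (evMu {y = y} e₀ below) (evMu {y = y′} e₀′ below′) with <-cmp y y′
... | tri< y<y′ _ _ = let (_ , e) = below′ y y<y′ in
  contradiction (Eval-deterministic e₀ e) λ ()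
... | tri≈ _ y≡y′ _ = y≡y′
... | tri> _ _ y′<y = let (_ , e) = below y′ y′<y in
  contradiction (Eval-deterministic e₀′ e) λ ()

muP-eval : ∀ {n} {f : Prog (suc n)} {xs y}
      → Eval f (y ∷ xs) 0
      → (∀ z → z < y → ∃ λ v → v ≢ 0 × Eval f (z ∷ xs) v)
      → Eval (muP f) xs y
muP-eval {f = f} {xs} e₀ below = evMu e₀ λ z z<y → nonzero (below z z<y)
  where
  nonzero : ∀ {z} → ∃ (λ v → v ≢ 0 × Eval f (z ∷ xs) v) → ∃ λ k → Eval f (z ∷ xs) (suc k)
  nonzero (zero  , v≢0 , _) = contradiction refl v≢0
  nonzero (suc k , _   , e) = k , e

Computes : Prog 1 → (ℕ → ℕ) → Set
Computes p h = ∀ x → Eval p (x ∷ []) (h x)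

comp₁ : ∀ {n} → Prog 1 → Prog n → Prog n
comp₁ q p = compP q (λ _ → p)

comp₂ : ∀ {n} → Prog 2 → Prog n → Prog n → Prog n
comp₂ h p q = compP h (lookup (p ∷ q ∷ []))

comp₁-eval : ∀ {n} {q : Prog 1} {p : Prog n} {xs y z}
           → Eval p xs y → Eval q (y ∷ []) z → Eval (comp₁ q p) xs z
comp₁-eval ep eq = evComp (λ _ → ep) eq

comp₁-inv : ∀ {n} {q : Prog 1} {p : Prog n} {xs z}
          → Eval (comp₁ q p) xs z → ∃ λ y → Eval p xs y × Eval q (y ∷ []) z
comp₁-inv (evComp {vs = vs} ep eq) = vs zero , ep zero , eq

comp₂-eval : ∀ {n} {h : Prog 2} {p q : Prog n} {xs a b c}
           → Eval p xs a → Eval q xs b → Eval h (a ∷ b ∷ []) c → Eval (comp₂ h p q) xs c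
comp₂-eval {a = a} {b} ep eq eh = evComp {vs = lookup (a ∷ b ∷ [])} args eh
  where
  args : ∀ i → Eval (lookup (_ ∷ _ ∷ []) i) _ (lookup (a ∷ b ∷ []) i)
  args zero       = ep
  args (suc zero) = eq

constP : ℕ → Prog 0
constP zero    = zeroP
constP (suc k) = comp₁ succP (constP k)

constP-eval : ∀ k → Eval (constP k) [] k
constP-eval zero    = evZero
constP-eval (suc k) = comp₁-eval (constP-eval k) evSucc

predP : Prog 1
predP = primP zeroP (projP zero)

predP-computes : Computes predP pred
predP-computes zero    = evPrim0 evZero
predP-computes (suc x) = evPrimS (predP-computes x) evProj

addP : Prog 2
addP = primP (projP zero) (comp₁ succP (projP (suc zero)))

addP-eval : ∀ m n → Eval addP (m ∷ n ∷ []) (m + n)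
addP-eval zero    n = evPrim0 evProj
addP-eval (suc m) n = evPrimS (addP-eval m n) (comp₁-eval evProj evSucc)

-- primP recurses on the first argument, hence the reversed argument order.
monusP : Prog 2
monusP = primP (projP zero) (comp₁ predP (projP (suc zero)))

monusP-eval : ∀ m n → Eval monusP (n ∷ m ∷ []) (m ∸ n)
monusP-eval m zero    = evPrim0 evProj
monusP-eval m (suc n) =
  subst (Eval monusP _) (pred[m∸n]≡m∸[1+n] m n)
        (evPrimS (monusP-eval m n) (comp₁-eval evProj (predP-computes (m ∸ n))))

distance : ℕ → ℕ → ℕ
distance m n = (n ∸ m) + (m ∸ n)

distance-self : ∀ n → distance n n ≡ 0
distance-self n = cong₂ _+_ (n∸n≡0 n) (n∸n≡0 n)

distance≡0⇒≡ : ∀ m n → distance m n ≡ 0 → m ≡ n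
distance≡0⇒≡ m n d≡0 =
  ≤-antisym (m∸n≡0⇒m≤n (m+n≡0⇒n≡0 (n ∸ m) d≡0)) (m∸n≡0⇒m≤n (m+n≡0⇒m≡0 (n ∸ m) d≡0))

distanceP : Prog 2
distanceP = comp₂ addP monusP (comp₂ monusP (projP (suc zero)) (projP zero))

distanceP-eval : ∀ m n → Eval distanceP (m ∷ n ∷ []) (distance m n)
distanceP-eval m n =
  comp₂-eval (monusP-eval n m) (comp₂-eval evProj evProj (monusP-eval m n)) (addP-eval _ _)

iterateP : ℕ → Prog 1 → Prog 1
iterateP start step = primP (constP start) (comp₁ step (projP (suc zero)))

iterateP-computes : ∀ (ρ : ℕ → ℕ) {step}
                  → (∀ n → Eval step (ρ n ∷ []) (ρ (suc n)))
                  → Computes (iterateP (ρ 0) step) ρ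
iterateP-computes ρ step-eval zero    = evPrim0 (constP-eval (ρ 0))
iterateP-computes ρ step-eval (suc n) =
  evPrimS (iterateP-computes ρ step-eval n) (comp₁-eval evProj (step-eval n))

-- μ-search for the least n with ρ n = w, which is the only one by injectivity.
module Inverse {ρ : ℕ → ℕ} (ρ-injective : Injective _≡_ _≡_ ρ)
               {R : Prog 1} (R-computes : Computes R ρ) where

  mismatchP : Prog 2
  mismatchP = comp₂ distanceP (comp₁ R (projP zero)) (projP (suc zero))

  mismatchP-eval : ∀ n w → Eval mismatchP (n ∷ w ∷ []) (distance (ρ n) w)
  mismatchP-eval n w =
    comp₂-eval (comp₁-eval evProj (R-computes n)) evProj (distanceP-eval (ρ n) w)

  inverseP : Prog 1
  inverseP = muP mismatchP

  inverseP-eval : ∀ n → Eval inverseP (ρ n ∷ []) n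
  inverseP-eval n =
    muP-eval (subst (Eval mismatchP _) (distance-self (ρ n)) (mismatchP-eval n (ρ n)))
          λ z z<n → distance (ρ z) (ρ n)
                  , (λ d≡0 → <-irrefl (ρ-injective (distance≡0⇒≡ _ _ d≡0)) z<n)
                  , mismatchP-eval z (ρ n)

  inverseP-sound : ∀ {w n} → Eval inverseP (w ∷ []) n → ρ n ≡ w
  inverseP-sound {w} {n} (evMu e₀ _) =
    distance≡0⇒≡ _ _ (Eval-deterministic (mismatchP-eval n w) e₀)

conjugate-PR : ∀ {ρ : ℕ → ℕ} {R : Prog 1} {f g : PFun}
             → Injective _≡_ _≡_ ρ → Computes R ρ → PR f → Commutes ρ g f → PR g
conjugate-PR {ρ} {R} {f} {g} ρ-injective R-computes (Pf , Pf-graph) commutes =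
  P , λ x y → mk⇔ (sound x y) (complete x y)
  where
  open Inverse ρ-injective R-computes

  P : Prog 1
  P = comp₁ inverseP (comp₁ Pf R)

  sound : ∀ x y → graph g x y → Eval P (x ∷ []) y
  sound x y gxy =
    comp₁-eval (comp₁-eval (R-computes x)
                           (to (Pf-graph (ρ x) (ρ y)) (to (commutes x (ρ y)) (y , gxy , refl))))
               (inverseP-eval y)

  complete : ∀ x y → Eval P (x ∷ []) y → graph g x y
  complete x y e with comp₁-inv e
  ... | w , eRf , eInv with comp₁-inv eRf
  ... | v , eR , ePf rewrite Eval-deterministic eR (R-computes x)
      with from (commutes x w) (from (Pf-graph (ρ x) w) ePf)
  ... | y′ , gxy′ , ρy′≡w with ρ-injective (trans (inverseP-sound eInv) (sym ρy′≡w))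
  ... | refl = gxy′

successor : PFun
successor = record { graph = λ x y → y ≡ suc x ; functional = λ p q → trans p (sym q) }

successor-PR : PR successor
successor-PR = succP , λ x y → mk⇔ (λ { refl → evSucc }) (λ { evSucc → refl })

simulated-successor⇒computable : ∀ {M : Model} {ρ : ℕ → ℕ}
                               → Simulates PR ρ M → M successor → ∃ λ R → Computes R ρ
simulated-successor⇒computable {ρ = ρ} simulates M-successor
  with simulates successor M-successor
... | f , (F , F-graph) , commutes =
  iterateP (ρ 0) F , iterateP-computes ρ λ n →
    to (F-graph (ρ n) (ρ (suc n))) (to (commutes n (ρ (suc n))) (suc n , refl , refl))

mainTheorem3 : (M : Model) → PR ⊆M M → PR ≿ M → M ≡M PR
mainTheorem3 M PR⊆M (ρ , ρ-injective , simulates) g = M⇒PR , PR⊆M g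
  where
  M⇒PR : M g → PR g
  M⇒PR Mg with simulated-successor⇒computable {M} {ρ} simulates (PR⊆M successor successor-PR)
             | simulates g Mg
  ... | R , R-computes | f , PR-f , commutes =
    conjugate-PR {ρ} {f = f} {g} ρ-injective R-computes PR-f commutes
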